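{- Let $\mathcal{C}=\langle X,T,A,q_0\rangle$ be a concurrent transition system, $Y\subseteq X$, and $\mathcal{C}'$ its transaction system with respect to $Y$, with state set $X'=X\times H$. Let $\mathbf{N}=\bigcap_{i\in P}N_i\subseteq X'$. Then $|\mathbf{N}|=|X|$, and every state $\langle q,h\rangle$ reachable from $q_0'$ via $\bigcup_{i\in P}\hookrightarrow_i$ satisfies that $q$ is reachable from $q_0$ in $\mathcal{C}$.
   Context: A concurrent transition system (CTS) for a finite set $P$ of processes is a tuple $\mathcal{C}=\langle X,T,A,q_0\rangle$ where $X$ is a set of states, $q_0\in X$, $A=\biguplus_{i\in P}A_i$ is a finite set of actions partitioned among the processes, and $T\subseteq X\times A\times X$; $T_i=T\cap(X\times A_i\times X)$. For $\alpha\in A$ let $\xrightarrow{\alpha}=\{(q,q')\mid (q,\alpha,q')\in T\}$; $\mathrm{en}(q)=\{\alpha\mid \exists q'\colon (q,\alpha,q')\in T\}$, $\mathrm{dis}(q)=A\setminus\mathrm{en}(q)$; $R\circ Q=\{(x,z)\mid\exists y\colon (x,y)\in R,(y,z)\in Q\}$; for a set $S$, $S\lhd R=R\cap(S\times X')$ and $R\rhd S=R\cap(X'\times S)$; $\overline{S}$ is the complement of $S$ in $X'$. $\alpha$ right-commutes with $\beta$ if $\xrightarrow{\alpha}\circ\xrightarrow{\beta}\subseteq\xrightarrow{\beta}\circ\xrightarrow{\alpha}$, left-commutes if $\supseteq$ holds. For each $q,\alpha$ a family $\mathrm{nes}_q(\alpha)$ of necessary enabling sets is given: each $E\in\mathrm{nes}_q(\alpha)$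 meets $\{\alpha_1,\dots,\alpha_n\}$ for every execution $q\xrightarrow{\alpha_1}\cdots\xrightarrow{\alpha_n}q''$ with $\alpha\in\mathrm{dis}(q)$, $\alpha\in\mathrm{en}(q'')$. For $\star\in\{\leftarrow,\rightarrow\}$, $B\subseteq A$ is semi-$\star$-stubborn in $q$ ($\mathrm{sst}^\star_q(B)$) if every $\alpha\in B\cap\mathrm{dis}(q)$ has some $E\in\mathrm{nes}_q(\alpha)$ with $E\subseteq B$, and for every $\alpha\in B\cap\mathrm{en}(q)$ and $\beta\in A$ such that $\alpha$ does not left-commute (for $\star=\leftarrow$), resp. right-commute (for $\star=\rightarrow$), with $\beta$, we have $\beta\in B$. $\mathrm{lm}_i(q)$ holds iff some $B$ has $\mathrm{sst}^\leftarrow_q(B)$ and $B\cap\mathrm{en}(q)=A_i\cap\mathrm{en}(q)$. $\mathrm{rm}_i(q,\alpha,q')$ holds iff some $B$ has $\mathrm{sst}^\rightarrow_q(B)$, $\alpha\in B$, $B\cap\mathrm{en}(q')\subseteq A_i$, $B\cap\mathrm{en}(q)=\{\alpha\}$. Let $A^Y_\oplus=\{\alpha\mid\exists (q,\alpha,q')\in T,\ q\notin Y,\ q'\in Y\}$ and $A^Y_\ominus=\{\alpha\mid\exists(q,\alpha,q')\in T,\ q\in Y,\ q'\notin Y\}$. Transaction system: $H=\{N,R,L\}^P$, $X'=X\times H$, $q_0'=\langle q_0,N^P\rangle$. For $i\in P$, $T'_i$ consists of the triples $(\langle q,h\rangle,\alpha,\langle q',h'\rangle)$ with $(q,\alpha,q')\in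 T_i$, $h'_j=h_j$ for all $j\neq i$, and: $h'_i=R$ if and only if $h_i\neq L$, $\mathrm{rm}_i(q,\alpha,q')$ and $\alpha\notin A^Y_\ominus$; otherwise $h'_i=L$ if $\mathrm{lm}_i(q')$ and $\mathrm{en}(q')\cap A_i\cap A^Y_\oplus=\emptyset$, where in that case the definition also allows $N$ as an alternative; otherwise $h'_i=N$ (the choice between $L$ and $N$ in the overlapping case is left open; fix any resolution). Let $N_i=\{\langle q,h\rangle\in X'\mid h_i=N\}$ and $\to'_i=\{(x,x')\mid \exists\alpha\colon (x,\alpha,x')\in T'_i\}$. Define $\rightsquigarrow_i=\big(\bigcap_{j\neq i}N_j\big)\lhd\to'_i$ and $\hookrightarrow_i=N_i\lhd\big(\rightsquigarrow_i\rhd\overline{N_i}\big)^*\circ\rightsquigarrow_i\rhd N_i$; the reduced transaction system has transition relation $\bigcup_i\hookrightarrow_i$ and initial state $q_0'$. -}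

module Defs where

open import Level using (Level; _⊔_) renaming (suc to lsuc; zero to lzero)
open import Data.Nat using (ℕ)
open import Data.Fin using (Fin)
open import Data.Bool using (Bool; true; false)
open import Data.Vec using (Vec; lookup)
open import Data.List using (List; []; _∷_)
open import Data.List.Relation.Unary.Any using (Any)
open import Data.Product using (Σ; ∃; _×_; _,_; proj₁; proj₂)
open import Data.Empty using (⊥)
open import Relation.Nullary using (¬_)
open import Relation.Binary.PropositionalEquality using (_≡_; _≢_)
open import Relation.Binary.Construct.Closure.ReflexiveTransitive using (Star)

-- Processes P = Fin nP, actions A = Fin nA, partition given by
-- owner : A → P  (A_i = { α | owner α ≡ i }).

module CTS {nP nA : ℕ} (owner : Fin nA → Fin nP)
           {X : Set} (T : X → Fin nA → X → Set) where

  Act : Set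
  Act = Fin nA

  Proc : Set
  Proc = Fin nP

  ActSet : Set₁
  ActSet = Act → Set

  En : X → Act → Set
  En q α = ∃ λ q' → T q α q'

  Dis : X → Act → Set
  Dis q α = ¬ En q α

  data Exec : X → List Act → X → Set where
    ε   : ∀ {q} → Exec q [] q
    _◅_ : ∀ {q q' q'' α αs} → T q α q' → Exec q' αs q'' → Exec q (α ∷ αs) q''

  IsNES : X → Act → ActSet → Set
  IsNES q α E = Dis q α → ∀ αs q'' → Exec q αs q'' → En q'' α → Any E αs

  -- a family nes_q(α) of sets (given as a predicate on subsets of A),
  -- each member of which is a necessary enabling set
  ValidNES : (X → Act → ActSet → Set) → Set₁
  ValidNES nes = ∀ q α E → nes q α E → IsNES q α E

  RightComm : Act → Act → Set
  RightComm α β = ∀ x y z → T x α y → T y β z → ∃ λ y' → T x β y' × T y' α z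

  LeftComm : Act → Act → Set
  LeftComm α β = ∀ x y z → T x β y → T y α z → ∃ λ y' → T x α y' × T y' β z

  data Dir : Set where
    left right : Dir

  Comm : Dir → Act → Act → Set
  Comm left  = LeftComm
  Comm right = RightComm

  _⊆_ : ActSet → ActSet → Set
  E ⊆ B = ∀ α → E α → B α

  SST : (X → Act → ActSet → Set) → Dir → X → ActSet → Set₁
  SST nes d q B =
      (∀ α → B α → Dis q α → Σ ActSet λ E → nes q α E × E ⊆ B)
    × (∀ α β → B α → En q α → ¬ Comm d α β → B β)

  _⇔_ : Set → Set → Set
  P ⇔ Q = (P → Q) × (Q → P)

  module WithNES (nes : X → Act → ActSet → Set) where

    lm : Proc → X → Set₁
    lm i q = Σ ActSet λ B → SST nes left q B
               × (∀ β → (B β × En q β) ⇔ (owner β ≡ i × En q β))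

    rm : Proc → X → Act → X → Set₁
    rm i q α q' = Σ ActSet λ B → SST nes right q B × B α
               × (∀ β → B β → En q' β → owner β ≡ i)
               × (∀ β → (B β × En q β) ⇔ (β ≡ α))

    module WithY (Y : X → Set) where

      Aplus : Act → Set
      Aplus α = ∃ λ q → ∃ λ q' → T q α q' × ¬ Y q × Y q'

      Aminus : Act → Set
      Aminus α = ∃ λ q → ∃ λ q' → T q α q' × Y q × ¬ Y q'

      data Mode : Set where
        N R L : Mode

      H : Set
      H = Vec Mode nP

      X' : Set
      X' = X × H

      q₀' : X → X'
      q₀' q₀ = q₀ , Data.Vec.replicate nP N

      -- a resolution of the L/N choice in the overlapping case:
      -- true = choose L, false = choose N
      Resolution : Set
      Resolution = X → H → Act → X → Bool

      module WithRes (res : Resolution) where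

        RCond : Proc → X → H → Act → X → Set₁
        RCond i q h α q' = (lookup h i ≢ L) × rm i q α q' × ¬ Aminus α

        LCond : Proc → X → Set₁
        LCond i q' = lm i q' × (∀ β → En q' β → owner β ≡ i → ¬ Aplus β)

        data NewMode (i : Proc) (q : X) (h : H) (α : Act) (q' : X) : Mode → Set₁ where
          toR  : RCond i q h α q' → NewMode i q h α q' R
          toL  : ¬ RCond i q h α q' → LCond i q' → res q h α q' ≡ true
               → NewMode i q h α q' L
          toN₁ : ¬ RCond i q h α q' → LCond i q' → res q h α q' ≡ false
               → NewMode i q h α q' N
          toN₂ : ¬ RCond i q h α q' → ¬ LCond i q'
               → NewMode i q h α q' N

        T' : Proc → X' → Act → X' → Set₁
        T' i (q , h) α (q' , h') =
            T q α q' × owner α ≡ i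
          × (∀ j → j ≢ i → lookup h' j ≡ lookup h j)
          × NewMode i q h α q' (lookup h' i)

        Nset : Proc → X' → Set
        Nset i (q , h) = lookup h i ≡ N

        Step' : Proc → X' → X' → Set₁
        Step' i x x' = ∃ λ α → T' i x α x'

        Squig : Proc → X' → X' → Set₁
        Squig i x x' = (∀ j → j ≢ i → Nset j x) × Step' i x x'

        SquigOut : Proc → X' → X' → Set₁
        SquigOut i x x' = Squig i x x' × ¬ Nset i x'

        Hook : Proc → X' → X' → Set₁
        Hook i x x'' = Nset i x × Nset i x''
          × ∃ λ x' → Star (SquigOut i) x x' × Squig i x' x''

        HookAny : X' → X' → Set₁
        HookAny x x' = ∃ λ i → Hook i x x'

        NN : X' → Set
        NN x = ∀ i → Nset i x

  Step : X → X → Set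
  Step q q' = ∃ λ α → T q α q'

-- |S| = |X| for a subset S ⊆ X' : a bijection between X and the
-- subset S (elements of S compared as elements of X').

record Bij {X X' : Set} (S : X' → Set) : Set where
  field
    to      : X → X'
    to∈     : ∀ q → S (to q)
    from    : X' → X
    from∘to : ∀ q → from (to q) ≡ q
    to∘from : ∀ x → S x → to (from x) ≡ x

module Submission where

-- Proof idea.  Both claims are about the projection  ⟨q , h⟩ ↦ q  from the
-- transaction system 𝒞' back to 𝒞.
--
-- (1) |𝐍| = |X|: a state lies in 𝐍 = ⋂ᵢ Nᵢ exactly when its history vector is
--     the constant vector N^P, and a vector is determined by its entries, so
--     q ↦ ⟨q , N^P⟩ and the projection are mutually inverse between X and 𝐍.
--
-- (2) Reachability: every step of ⇝ᵢ is a step of Tᵢ' and hence projects to a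
--     single step of 𝒞; consequently a ↪ᵢ step (a ⇝ᵢ-path followed by a ⇝ᵢ
--     step) projects to a path of 𝒞, and so does any path of ⋃ᵢ ↪ᵢ.

open import Defs
open import Data.Nat using (ℕ)
open import Data.Fin using (Fin; zero; suc)
open import Data.Product using (_×_; _,_; proj₁)
open import Data.Vec using (Vec; []; _∷_; lookup; replicate)
open import Data.Vec.Properties using (lookup-replicate)
open import Relation.Binary.PropositionalEquality using (_≡_; refl; sym; cong; cong₂)
open import Relation.Binary.Construct.Closure.ReflexiveTransitive
  using (Star; ε; _◅_; _◅◅_; kleisliStar)

replicate-unique : ∀ {A : Set} {n} (a : A) (h : Vec A n)
                 → (∀ i → lookup h i ≡ a) → replicate n a ≡ h
replicate-unique a []      all-a = refl
replicate-unique a (x ∷ h) all-a =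
  cong₂ _∷_ (sym (all-a zero)) (replicate-unique a h (λ i → all-a (suc i)))

module TransactionSystem {nP nA : ℕ} (owner : Fin nA → Fin nP)
         {X : Set} (T : X → Fin nA → X → Set)
         (nes : X → Fin nA → (Fin nA → Set) → Set)
         (Y : X → Set) (res : CTS.WithNES.WithY.Resolution owner T nes Y) where

  open CTS owner T
  open WithNES nes
  open WithY Y
  open WithRes res

  -- The states of 𝐍 are exactly the pairs ⟨q , N^P⟩, hence in bijection with X.
  N-bijection : Bij {X} NN
  N-bijection = record
    { to      = λ q → q , replicate nP N
    ; to∈     = λ q i → lookup-replicate i N
    ; from    = proj₁
    ; from∘to = λ q → refl
    ; to∘from = λ { (q , h) allN → cong (q ,_) (replicate-unique N h allN) }
    }

  Projects : (X' → X' → Set₁) → Set₁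
  Projects step = ∀ {x y} → step x y → Star Step (proj₁ x) (proj₁ y)

  project-star : ∀ {step} → Projects step → Projects (Star step)
  project-star = kleisliStar proj₁

  squig-projects : ∀ i → Projects (Squig i)
  squig-projects i {_ , _} {_ , _} (_ , α , t , _) = (α , t) ◅ ε

  hook-projects : ∀ i → Projects (Hook i)
  hook-projects i {_} {z} (_ , _ , y , path , last) =
    project-star (λ {u} {v} step → squig-projects i {u} {v} (proj₁ step)) path
    ◅◅ squig-projects i {y} {z} last

  reduced-projects : Projects (Star HookAny)
  reduced-projects = project-star (λ { {x} {y} (i , hook) → hook-projects i {x} {y} hook })

theorem5 : (nP nA : ℕ) (owner : Fin nA → Fin nP)
    (X : Set) (T : X → Fin nA → X → Set) (q₀ : X)
    (nes : X → Fin nA → (Fin nA → Set) → Set)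
    → CTS.ValidNES owner T nes
    → (Y : X → Set)
    → (res : CTS.WithNES.WithY.Resolution owner T nes Y)
    → Bij {X} (CTS.WithNES.WithY.WithRes.NN owner T nes Y res)
    × (∀ q h → Star (CTS.WithNES.WithY.WithRes.HookAny owner T nes Y res)
    (CTS.WithNES.WithY.q₀' owner T nes Y q₀) (q , h)
    → Star (CTS.Step owner T) q₀ q)
theorem5 nP nA owner X T q₀ nes _ Y res =
  N-bijection , λ q h reduced-path → reduced-projects reduced-path
  where open TransactionSystem owner T nes Y res
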